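{- Let $\alpha=(\alpha_1,\ldots,\alpha_{2s})$ be a composition of $n$ and $\mathrm{sh}(\alpha)=(\alpha_2,\ldots,\alpha_{2s},\alpha_1)$. Let $\kappa$ be the complement map from lower ideals of $\overline{F}(\alpha)$ to lower ideals of $\overline{F}(\mathrm{sh}(\alpha))$. Then for every lower ideal $I$ of $\overline{F}(\alpha)$, $\kappa(\rho(I))=\rho^{ -1}(\kappa(I))$, so $\kappa$ maps rowmotion orbits to rowmotion orbits; and for every rowmotion orbit $\mathcal{O}$ on $\overline{F}(\alpha)$, $\mathcal{M}(\mathcal{O})=\mathcal{M}(\kappa(\mathcal{O}))$ and $\overline{\chi}(\mathcal{O})+\overline{\chi}(\kappa(\mathcal{O}))=n|\mathcal{O}|$.
   Context: A composition of $n$ is a sequence of positive integers summing to $n$. For $\alpha=(\alpha_1,\ldots,\alpha_{2s})$ a composition of $n$, the circular fence $\overline{F}(\alpha)$ is the poset on $x_1,\ldots,x_n$ (indices mod $n$) generated by $x_1\preceq\cdots\preceq x_{\alpha_1+1}\succeq\cdots\succeq x_{\alpha_1+\alpha_2+1}\preceq\cdots\succeq x_{n+1}=x_1$ (first $\alpha_1$ steps up, next $\alpha_2$ down, alternately). If $y_1,\ldots,y_n$ are the elements of $\overline{F}(\mathrm{sh}(\alpha))$ similarly labelled, then $x_j\mapsto y_{j-\alpha_1}$ (indices mod $n$) is an isomorphism from the dual of $\overline{F}(\alpha)$ onto $\overline{F}(\mathrm{sh}(\alpha))$, and $\kappa(I)=\{y_{j-\alpha_1}: x_j\notin I\}$.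 Rowmotion $\rho$ sends a lower ideal $I$ to the lower ideal generated by the minimal elements of the complement of $I$; orbits are its orbits. For an orbit $\mathcal{O}$, $\mathcal{M}(\mathcal{O})=\sum_{I\in\mathcal{O}}(\text{number of maximal elements of } I)$ and $\overline{\chi}(\mathcal{O})=\sum_{I\in\mathcal{O}}|I|$. -}

module Defs where

open import Data.Bool using (Bool; true; false; not; _∧_; _∨_; if_then_else_; T)
open import Data.Nat using (ℕ; zero; suc; _+_; _*_; _∸_; _<ᵇ_; _≤_)
open import Data.Nat.DivMod using (_mod_)
open import Data.Fin using (Fin; toℕ; _≟_)
open import Data.List using (List; []; _∷_; _++_; [_]; map; upTo; allFin; length; filter)
open import Data.Bool.ListAction using (any; all)
open import Data.Nat.ListAction using (sum)
open import Relation.Nullary.Decidable using (⌊_⌋)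
open import Relation.Binary.PropositionalEquality using (_≡_)
open import Function using (_∘_)

-- first part (α₁); only used for nonempty lists
head₀ : List ℕ → ℕ
head₀ []      = 0
head₀ (a ∷ _) = a

sh : List ℕ → List ℕ
sh []       = []
sh (a ∷ as) = as ++ [ a ]

-- Element x_{i+1} (1-based) is represented by i : Fin n (0-based).
-- Step number j (0-based) goes from x_{j+1} to x_{j+2} (indices mod n).
-- The first β₁ steps go up, the next β₂ down, alternately.

upAux : Bool → List ℕ → ℕ → Bool
upAux p []       j = p
upAux p (a ∷ as) j = if j <ᵇ a then p else upAux (not p) as (j ∸ a)

upStep : List ℕ → ℕ → Bool
upStep β j = upAux true β j

shift : ∀ {n} → Fin n → ℕ → Fin n
shift {suc m} i k = (toℕ i + k) mod suc m

_==_ : ∀ {n} → Fin n → Fin n → Bool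
a == b = ⌊ a ≟ b ⌋

cover : (β : List ℕ) (n : ℕ) → Fin n → Fin n → Bool
cover β n a b =
  (b == shift a 1 ∧ upStep β (toℕ a)) ∨ (a == shift b 1 ∧ not (upStep β (toℕ b)))

reach : (β : List ℕ) (n : ℕ) → ℕ → Fin n → Fin n → Bool
reach β n zero    a b = a == b
reach β n (suc k) a b = reach β n k a b ∨ any (λ c → reach β n k a c ∧ cover β n c b) (allFin n)

-- the partial order of F̄(β) generated by the relations (reflexive–transitive closure;
-- chains of length ≤ n suffice on n elements)
leq : (β : List ℕ) (n : ℕ) → Fin n → Fin n → Bool
leq β n = reach β n n

Subset : ℕ → Set
Subset n = Fin n → Bool

_≗ₛ_ : ∀ {n} → Subset n → Subset n → Set
I ≗ₛ J = ∀ i → I i ≡ J i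

IsLowerIdeal : (β : List ℕ) (n : ℕ) → Subset n → Set
IsLowerIdeal β n I = ∀ a b → T (leq β n a b) → T (I b) → T (I a)

minCompl : (β : List ℕ) (n : ℕ) → Subset n → Fin n → Bool
minCompl β n I m = not (I m) ∧ all (λ y → not (leq β n y m ∧ not (I y)) ∨ (y == m)) (allFin n)

ρ : (β : List ℕ) (n : ℕ) → Subset n → Subset n
ρ β n I x = any (λ m → minCompl β n I m ∧ leq β n x m) (allFin n)

iter : ∀ {A : Set} → (A → A) → ℕ → A → A
iter f zero    x = x
iter f (suc k) x = f (iter f k x)

-- κ(I) = { y_{j-α₁} : x_j ∉ I }, i.e. κ(I)(i) = not I(i + α₁ mod n)
κ : (α : List ℕ) (n : ℕ) → Subset n → Subset n
κ α n I i = not (I (shift i (head₀ α)))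

count : ∀ {n} → (Fin n → Bool) → ℕ
count {n} P = length (filter (λ i → T? (P i)) (allFin n))
  where
  open import Relation.Nullary.Decidable using (Dec)
  open import Data.Bool.Properties using (T?)

maxCount : (β : List ℕ) (n : ℕ) → Subset n → ℕ
maxCount β n I = count (λ x → I x ∧ all (λ y → not (leq β n x y ∧ I y) ∨ (y == x)) (allFin n))

size : ∀ {n} → Subset n → ℕ
size I = count I

orbitSum : (β : List ℕ) (n : ℕ) → (Subset n → ℕ) → ℕ → Subset n → ℕ
orbitSum β n f k I = sum (map (λ i → f (iter (ρ β n) i I)) (upTo k))

{-# OPTIONS --safe #-}
-- Rotating the circle by α₁ turns F̄(sh α) into the dual of F̄(α): as the number of parts is
-- even, the up-steps of one fence lie exactly over the down-steps of the other. Hence κ, which is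
-- complementation transported along this rotation, exchanges the maximal elements of J with the
-- minimal elements outside κ(J), and the minimal elements outside J with the maximal elements of
-- κ(J). Rowmotion is characterised by the fact that the maximal elements of ρ(I) are exactly the
-- minimal elements of the complement of I. So ρ(κ(ρ I)) is the lower ideal generated by the images
-- of the minimal elements outside I, which is κ(I) because every element outside the lower ideal I
-- lies above one of them. The same facts give maxCount(κ J) = #min(complement of J) = maxCount(ρ J)
-- and |J| + |κ J| = n for every J; summing over an orbit, on which ρ only shifts the index, yields
-- both identities.
--
-- The order of a circular fence is handled through an explicit description: x ⪯ y iff y is reached
-- from x by a run of up-steps or x from y by a run of down-steps. This needs steps in both
-- directions, so that no run winds around the whole circle.

module Submission where

open import Defs
open import Data.Bool using (Bool; true; false; not; _∧_; _∨_; if_then_else_; T)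
open import Data.Bool.ListAction using (and; any; all)
open import Data.Bool.Properties using (T?; T-∧; T-∨; T-≡; T-not-≡; not-¬; not-involutive; not-injective)
open import Data.Empty using (⊥-elim)
open import Data.Fin using (Fin; toℕ; fromℕ<; _≟_) renaming (zero to fzero; suc to fsuc)
open import Data.Fin.Permutation using (permutation)
open import Data.Fin.Properties using (toℕ-fromℕ<; toℕ-injective; toℕ<n)
open import Data.List using (List; []; _∷_; [_]; _++_; _∷ʳ_; length; filter; allFin; tabulate; upTo; applyUpTo)
open import Data.List.Membership.Propositional using (_∈_; lose)
open import Data.List.Membership.Propositional.Properties using (∈-allFin)
open import Data.List.Properties using (length-tabulate; filter-≐; map-cong; map-upTo; applyUpTo-∷ʳ)
import Data.List.Relation.Unary.All as All
open All using (All; _∷_)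
open import Data.List.Relation.Unary.All.Properties using (all⁺; all⁻)
open import Data.List.Relation.Unary.Any using (here; there; satisfied)
open import Data.List.Relation.Unary.Any.Properties using (any⁺; any⁻)
open import Data.Nat using (ℕ; zero; suc; _+_; _*_; _∸_; _<ᵇ_; _%_; _≤_; _<_; z≤n; s≤s; z<s; s≤s⁻¹)
open import Data.Nat.DivMod using (%-distribˡ-+; m%n%n≡m%n; [m+n]%n≡m%n; m<n⇒m%n≡m; m≤n⇒[n∸m]%m≡n%m)
open import Data.Nat.Induction using (<-wellFounded)
open import Data.Nat.ListAction using (sum)
open import Data.Nat.ListAction.Properties using (sum-++)
open import Data.Nat.Properties
  using ( _<?_; ≤-refl; <⇒≤; <-irrefl; <-≤-trans; ≮⇒≥; m≤n⇒m≤1+n; m≤n⇒m<n∨m≡n; <ᵇ⇒<; <⇒<ᵇ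
        ; +-suc; +-comm; +-assoc; +-identityʳ; +-cancelˡ-≡; +-cancelˡ-<; +-mono-<; +-monoˡ-<
        ; m<m+n; m≤m+n; m+n≮m; m+n≡0⇒m≡0; m+[n∸m]≡n; m∸n+n≡m; m+n∸m≡n; m<n+o⇒m∸n<o; ∸-monoˡ-<
        ; *-suc; *-zeroʳ; +-0-commutativeMonoid; +-commutativeSemigroup )
open import Algebra.Properties.CommutativeSemigroup +-commutativeSemigroup using () renaming (interchange to +-interchange)
import Algebra.Properties.CommutativeMonoid.Sum +-0-commutativeMonoid as ℕ-Sum
open import Data.Product using (_×_; _,_; proj₁; ∃-syntax)
open import Data.Sum using (inj₁; inj₂)
open import Data.Unit using (tt)
open import Function using (_∘_; _⇔_; mk⇔; Equivalence; case_of_)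
open Equivalence using (to; from)
import Function.Properties.Equivalence as ⇔
open import Induction.WellFounded using (Acc; acc)
open import Relation.Binary.PropositionalEquality
  using (_≡_; _≢_; refl; sym; trans; cong; cong₂; subst; subst₂; isEquivalence; module ≡-Reasoning)
open import Relation.Binary.Structures using (IsPartialOrder)
open import Relation.Nullary using (¬_; yes; no)
open import Relation.Nullary.Decidable using (toWitness; fromWitness)

T-not : ∀ {b} → T (not b) ⇔ (¬ T b)
T-not {true}  = mk⇔ (λ ()) (λ ¬t → ¬t tt)
T-not {false} = mk⇔ (λ _ ()) (λ _ → tt)

¬T-not : ∀ {b} → (¬ T (not b)) ⇔ T b
¬T-not {true}  = mk⇔ (λ _ → tt) (λ _ ())
¬T-not {false} = mk⇔ (λ ¬t → ¬t tt) (λ ())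

T-== : ∀ {n} {x y : Fin n} → T (x == y) ⇔ x ≡ y
T-== = mk⇔ toWitness fromWitness

T-implies : ∀ a c e → T (not (a ∧ c) ∨ e) ⇔ (T a → T c → T e)
T-implies true  true  e = mk⇔ (λ t _ _ → t) (λ f → f tt tt)
T-implies true  false e = mk⇔ (λ _ _ ()) (λ _ → tt)
T-implies false c     e = mk⇔ (λ _ ()) (λ _ → tt)

⇔⇒≡ : ∀ {x y} → (T x ⇔ T y) → x ≡ y
⇔⇒≡ {false} {false} _ = refl
⇔⇒≡ {false} {true}  e = ⊥-elim (from e tt)
⇔⇒≡ {true}  {false} e = ⊥-elim (to e tt)
⇔⇒≡ {true}  {true}  _ = refl

T-any-allFin : ∀ {n} (p : Fin n → Bool) → T (any p (allFin n)) ⇔ (∃[ x ] T (p x))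
T-any-allFin {n} p = mk⇔ (satisfied ∘ any⁻ p (allFin n)) (λ (x , px) → any⁺ p (lose {P = T ∘ p} (∈-allFin x) px))

T-all-allFin : ∀ {n} (p : Fin n → Bool) → T (all p (allFin n)) ⇔ (∀ x → T (p x))
T-all-allFin {n} p = mk⇔ (λ t x → All.lookup (all⁺ p (allFin n) t) (∈-allFin x))
                         (λ f → all⁻ p {allFin n} (All.tabulate (λ {x} _ → f x)))

module _ {A : Set} {P Q : A → Bool} (P⇒Q : ∀ x → T (P x) → T (Q x)) where

  length-filter-mono : ∀ xs → length (filter (T? ∘ P) xs) ≤ length (filter (T? ∘ Q) xs)
  length-filter-mono []       = z≤n
  length-filter-mono (x ∷ xs) with P x | Q x | P⇒Q x
  ... | true  | true  | _  = s≤s (length-filter-mono xs)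
  ... | true  | false | pq = ⊥-elim (pq tt)
  ... | false | true  | _  = m≤n⇒m≤1+n (length-filter-mono xs)
  ... | false | false | _  = length-filter-mono xs

  length-filter-strict : ∀ {c xs} → c ∈ xs → T (Q c) → ¬ T (P c) →
                         length (filter (T? ∘ P) xs) < length (filter (T? ∘ Q) xs)
  length-filter-strict {c} {_ ∷ xs} (here refl) qc ¬pc with P c | Q c | P⇒Q c
  ... | true  | _     | _ = ⊥-elim (¬pc tt)
  ... | false | true  | _ = s≤s (length-filter-mono xs)
  ... | false | false | _ = ⊥-elim qc
  length-filter-strict {xs = x ∷ xs} (there c∈xs) qc ¬pc with P x | Q x | P⇒Q x
  ... | true  | true  | _  = s≤s (length-filter-strict c∈xs qc ¬pc)
  ... | true  | false | pq = ⊥-elim (pq tt)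
  ... | false | true  | _  = m≤n⇒m≤1+n (length-filter-strict c∈xs qc ¬pc)
  ... | false | false | _  = length-filter-strict c∈xs qc ¬pc

length-filter-complement : ∀ {A : Set} (P : A → Bool) xs →
  length (filter (T? ∘ P) xs) + length (filter (T? ∘ not ∘ P) xs) ≡ length xs
length-filter-complement P []       = refl
length-filter-complement P (x ∷ xs) with P x
... | true  = cong suc (length-filter-complement P xs)
... | false = trans (+-suc _ _) (cong suc (length-filter-complement P xs))

module _ {n : ℕ} where

  count-cong : {P Q : Fin n → Bool} → (∀ x → T (P x) ⇔ T (Q x)) → count P ≡ count Q
  count-cong P⇔Q = cong length (filter-≐ (T? ∘ _) (T? ∘ _)
                     ((λ {x} → to (P⇔Q x)) , λ {x} → from (P⇔Q x)) (allFin n))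

  count-< : {P Q : Fin n → Bool} → (∀ x → T (P x) → T (Q x)) →
            ∀ c → T (Q c) → ¬ T (P c) → count P < count Q
  count-< P⇒Q c = length-filter-strict P⇒Q (∈-allFin c)

  count-complement : (P : Fin n → Bool) → count P + count (not ∘ P) ≡ n
  count-complement P = trans (length-filter-complement P (allFin n)) (length-tabulate _)

  count≡∑ : (P : Fin n → Bool) → count P ≡ ℕ-Sum.sum (λ i → if P i then 1 else 0)
  count≡∑ P = go n (λ i → i)
    where
    go : ∀ k (g : Fin k → Fin n) →
         length (filter (T? ∘ P) (tabulate g)) ≡ ℕ-Sum.sum (λ i → if P (g i) then 1 else 0)
    go zero    g = refl
    go (suc k) g with P (g fzero)
    ... | true  = cong suc (go k (g ∘ fsuc))
    ... | false = go k (g ∘ fsuc)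

  count-∘-bijection : (f g : Fin n → Fin n) → (∀ x → f (g x) ≡ x) → (∀ x → g (f x) ≡ x) →
                      (P : Fin n → Bool) → count (P ∘ f) ≡ count P
  count-∘-bijection f g fg gf P = begin
    count (P ∘ f)                                          ≡⟨ count≡∑ (P ∘ f) ⟩
    ℕ-Sum.sum (λ i → if P (f i) then 1 else 0)              ≡⟨ ℕ-Sum.sum-permute _ (permutation f g fg gf) ⟨
    ℕ-Sum.sum (λ i → if P i then 1 else 0)                  ≡⟨ count≡∑ P ⟨
    count P                                                ∎
    where open ≡-Reasoning

module Shift (m : ℕ) where

  infixl 6 _⊕_

  _⊕_ : Fin (suc m) → ℕ → Fin (suc m)
  x ⊕ k = shift x k

  toℕ-⊕ : ∀ x k → toℕ (x ⊕ k) ≡ (toℕ x + k) % suc m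
  toℕ-⊕ x k = toℕ-fromℕ< _

  toℕ-⊕-< : ∀ x k → toℕ x + k < suc m → toℕ (x ⊕ k) ≡ toℕ x + k
  toℕ-⊕-< x k lt = trans (toℕ-⊕ x k) (m<n⇒m%n≡m lt)

  ⊕-assoc : ∀ x i j → x ⊕ i ⊕ j ≡ x ⊕ (i + j)
  ⊕-assoc x i j = toℕ-injective (begin
    toℕ (x ⊕ i ⊕ j)                          ≡⟨ toℕ-⊕ (x ⊕ i) j ⟩
    (toℕ (x ⊕ i) + j) % suc m                 ≡⟨ cong (λ v → (v + j) % suc m) (toℕ-⊕ x i) ⟩
    ((toℕ x + i) % suc m + j) % suc m          ≡⟨ %-distribˡ-+ ((toℕ x + i) % suc m) j (suc m) ⟩
    ((toℕ x + i) % suc m % suc m + j % suc m) % suc m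
                                              ≡⟨ cong (λ v → (v + j % suc m) % suc m) (m%n%n≡m%n (toℕ x + i) (suc m)) ⟩
    ((toℕ x + i) % suc m + j % suc m) % suc m  ≡⟨ %-distribˡ-+ (toℕ x + i) j (suc m) ⟨
    (toℕ x + i + j) % suc m                   ≡⟨ cong (_% suc m) (+-assoc (toℕ x) i j) ⟩
    (toℕ x + (i + j)) % suc m                 ≡⟨ toℕ-⊕ x (i + j) ⟨
    toℕ (x ⊕ (i + j))                         ∎)
    where open ≡-Reasoning

  ⊕-suc : ∀ x k → x ⊕ k ⊕ 1 ≡ x ⊕ suc k
  ⊕-suc x k = trans (⊕-assoc x k 1) (cong (x ⊕_) (+-comm k 1))

  ⊕-identityʳ : ∀ x → x ⊕ 0 ≡ x
  ⊕-identityʳ x = toℕ-injective (trans (toℕ-⊕ x 0)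
                    (trans (cong (_% suc m) (+-identityʳ (toℕ x))) (m<n⇒m%n≡m (toℕ<n x))))

  ⊕-period : ∀ x → x ⊕ suc m ≡ x
  ⊕-period x = toℕ-injective (trans (toℕ-⊕ x (suc m)) (trans ([m+n]%n≡m%n (toℕ x) (suc m)) (m<n⇒m%n≡m (toℕ<n x))))

  ⊕-inverse : ∀ {i j} → i + j ≡ suc m → ∀ x → x ⊕ i ⊕ j ≡ x
  ⊕-inverse i+j≡n x = trans (⊕-assoc x _ _) (trans (cong (x ⊕_) i+j≡n) (⊕-period x))

  ⊕-cancelʳ : ∀ {i} j → i + j ≡ suc m → ∀ {x y} → x ⊕ i ≡ y ⊕ i → x ≡ y
  ⊕-cancelʳ j i+j≡n {x} {y} e =
    trans (sym (⊕-inverse i+j≡n x)) (trans (cong (_⊕ j) e) (⊕-inverse i+j≡n y))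

  ⊕-comm : ∀ x i j → x ⊕ i ⊕ j ≡ x ⊕ j ⊕ i
  ⊕-comm x i j = trans (⊕-assoc x i j) (trans (cong (x ⊕_) (+-comm i j)) (sym (⊕-assoc x j i)))

  ⊕-toℕ-swap : ∀ x y → x ⊕ toℕ y ≡ y ⊕ toℕ x
  ⊕-toℕ-swap x y = toℕ-injective (trans (toℕ-⊕ x (toℕ y))
                     (trans (cong (_% suc m) (+-comm (toℕ x) (toℕ y))) (sym (toℕ-⊕ y (toℕ x)))))

  ⊕-surjective : ∀ x y → ∃[ i ] i < suc m × x ⊕ i ≡ y
  ⊕-surjective x y = toℕ z , toℕ<n z , (begin
    x ⊕ toℕ z                     ≡⟨ ⊕-toℕ-swap x z ⟩
    z ⊕ toℕ x                     ≡⟨ ⊕-inverse (m∸n+n≡m (<⇒≤ (toℕ<n x))) y ⟩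
    y                             ∎)
    where
    open ≡-Reasoning
    z = y ⊕ (suc m ∸ toℕ x)

  ⊕-fixed : ∀ x k → x ⊕ k ≡ x → k < suc m → k ≡ 0
  ⊕-fixed x k x⊕k≡x k<n with toℕ x + k <? suc m
  ... | yes lt = +-cancelˡ-≡ (toℕ x) k 0 (begin
    toℕ x + k        ≡⟨ toℕ-⊕-< x k lt ⟨
    toℕ (x ⊕ k)      ≡⟨ cong toℕ x⊕k≡x ⟩
    toℕ x            ≡⟨ +-identityʳ (toℕ x) ⟨
    toℕ x + 0        ∎)
    where open ≡-Reasoning
  ... | no ≮ = ⊥-elim (<-irrefl k≡n k<n)
    where
    open ≡-Reasoning
    n≤x+k : suc m ≤ toℕ x + k
    n≤x+k = ≮⇒≥ ≮
    wrapped : toℕ x + k ∸ suc m ≡ toℕ x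
    wrapped = begin
      toℕ x + k ∸ suc m               ≡⟨ m<n⇒m%n≡m (m<n+o⇒m∸n<o _ (suc m) (+-mono-< (toℕ<n x) k<n)) ⟨
      (toℕ x + k ∸ suc m) % suc m     ≡⟨ m≤n⇒[n∸m]%m≡n%m n≤x+k ⟩
      (toℕ x + k) % suc m             ≡⟨ toℕ-⊕ x k ⟨
      toℕ (x ⊕ k)                     ≡⟨ cong toℕ x⊕k≡x ⟩
      toℕ x                           ∎
    k≡n : k ≡ suc m
    k≡n = +-cancelˡ-≡ (toℕ x) k (suc m) (begin
      toℕ x + k                       ≡⟨ m∸n+n≡m n≤x+k ⟨
      toℕ x + k ∸ suc m + suc m       ≡⟨ cong (_+ suc m) wrapped ⟩
      toℕ x + suc m                   ∎)

module CircularFence (β : List ℕ) (m : ℕ) where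

  open Shift m

  dir : Fin (suc m) → Bool
  dir x = upStep β (toℕ x)

  infixr 5 _∷_

  data Run (b : Bool) : Fin (suc m) → ℕ → Set where
    []  : ∀ {x} → Run b x 0
    _∷_ : ∀ {x k} → dir x ≡ b → Run b (x ⊕ 1) k → Run b x (suc k)

  module _ {b : Bool} where

    Run-head : ∀ {x k} → Run b x (suc k) → dir x ≡ b
    Run-head (d ∷ _) = d

    Run-at : ∀ {x k i} → Run b x k → i < k → dir (x ⊕ i) ≡ b
    Run-at {x} {i = zero}  (d ∷ _) _         = trans (cong dir (⊕-identityʳ x)) d
    Run-at {x} {i = suc i} (_ ∷ r) (s≤s i<k) = trans (cong dir (sym (⊕-assoc x 1 i))) (Run-at r i<k)

    Run-init : ∀ {x k} → Run b x (suc k) → Run b x k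
    Run-init (d ∷ [])      = []
    Run-init (d ∷ d′ ∷ r)  = d ∷ Run-init (d′ ∷ r)

    Run-snoc : ∀ {x k} → Run b x k → dir (x ⊕ k) ≡ b → Run b x (suc k)
    Run-snoc {x}         []       d = trans (cong dir (sym (⊕-identityʳ x))) d ∷ []
    Run-snoc {x} {suc k} (d′ ∷ r) d = d′ ∷ Run-snoc r (trans (cong dir (⊕-assoc x 1 k)) d)

    Run-++ : ∀ {x k j} → Run b x k → Run b (x ⊕ k) j → Run b x (k + j)
    Run-++ {x} {j = j} []            r′ = subst (λ z → Run b z j) (⊕-identityʳ x) r′
    Run-++ {x} {suc k} {j} (d ∷ r) r′ = d ∷ Run-++ r (subst (λ z → Run b z j) (sym (⊕-assoc x 1 k)) r′)

  infix 4 _≼_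

  data _≼_ (x y : Fin (suc m)) : Set where
    ascent  : ∀ k → y ≡ x ⊕ k → Run true x k → x ≼ y
    descent : ∀ k → x ≡ y ⊕ k → Run false y k → x ≼ y

  ≼-refl : ∀ x → x ≼ x
  ≼-refl x = ascent 0 (sym (⊕-identityʳ x)) []

  infix 4 _⋖_

  data _⋖_ (c d : Fin (suc m)) : Set where
    up   : d ≡ c ⊕ 1 → dir c ≡ true → c ⋖ d
    down : c ≡ d ⊕ 1 → dir d ≡ false → c ⋖ d

  T-cover : ∀ {c d} → T (cover β (suc m) c d) ⇔ c ⋖ d
  T-cover = mk⇔ cover⇒⋖ ⋖⇒cover
    where
    cover⇒⋖ : ∀ {c d} → T (cover β (suc m) c d) → c ⋖ d
    cover⇒⋖ {c} {d} t with to (T-∨ {(d == (c ⊕ 1)) ∧ dir c}) t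
    ... | inj₁ t↑ = let e , u = to T-∧ t↑ in up (toWitness e) (to T-≡ u)
    ... | inj₂ t↓ = let e , u = to T-∧ t↓ in down (toWitness e) (to T-not-≡ u)
    ⋖⇒cover : ∀ {c d} → c ⋖ d → T (cover β (suc m) c d)
    ⋖⇒cover {c} {d} (up e u) =
      from (T-∨ {(d == (c ⊕ 1)) ∧ dir c})
        (inj₁ (from T-∧ (from T-== e , from T-≡ u)))
    ⋖⇒cover {c} {d} (down e u) =
      from (T-∨ {(d == (c ⊕ 1)) ∧ dir c})
        (inj₂ (from T-∧ (from T-== e , from T-not-≡ u)))

  ≼-⋖ : ∀ {x c d} → x ≼ c → c ⋖ d → x ≼ d
  ≼-⋖ {x} (ascent k c≡ r) (up d≡ u) =
    ascent (suc k) (trans d≡ (trans (cong (_⊕ 1) c≡) (⊕-suc x k))) (Run-snoc r (trans (cong dir (sym c≡)) u))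
  ≼-⋖ {x} (ascent zero c≡ _) (down c≡′ u) =
    descent 1 (trans (sym (⊕-identityʳ x)) (trans (sym c≡) c≡′)) (u ∷ [])
  ≼-⋖ {x} (ascent (suc k) c≡ r) (down c≡′ u) = case trans (sym (Run-at r ≤-refl)) (trans (cong dir d≡) u) of λ ()
    where
    d≡ : x ⊕ k ≡ _
    d≡ = ⊕-cancelʳ m refl (trans (⊕-suc x k) (trans (sym c≡) c≡′))
  ≼-⋖ {c = c} (descent zero x≡ _) (up d≡ u) =
    ascent 1 (trans d≡ (cong (_⊕ 1) (trans (sym (⊕-identityʳ c)) (sym x≡))))
             (trans (cong dir (trans x≡ (⊕-identityʳ c))) u ∷ [])
  ≼-⋖ (descent (suc _) _ r) (up _ u) = case trans (sym (Run-head r)) u of λ ()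
  ≼-⋖ {d = d} (descent k x≡ r) (down c≡ u) =
    descent (suc k) (trans x≡ (trans (cong (_⊕ k) c≡) (⊕-assoc d 1 k))) (u ∷ subst (λ z → Run false z k) c≡ r)

  ≼-reach : ∀ k {x y z} → x ≼ y → T (reach β (suc m) k y z) → x ≼ z
  ≼-reach zero    x≼y t = subst (_ ≼_) (toWitness t) x≼y
  ≼-reach (suc k) {y = y} {z} x≼y t with to (T-∨ {reach β (suc m) k y z}) t
  ... | inj₁ t′ = ≼-reach k x≼y t′
  ... | inj₂ t′ = let c , t″ = to (T-any-allFin _) t′
                      y≤c , c⋖z = to (T-∧ {reach β (suc m) k y c}) t″
                  in ≼-⋖ (≼-reach k x≼y y≤c) (to T-cover c⋖z)

  reach-snoc : ∀ {k x c y} → T (reach β (suc m) k x c) → c ⋖ y → T (reach β (suc m) (suc k) x y)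
  reach-snoc {k} {x} {c} {y} x≤c c⋖y =
    from (T-∨ {reach β (suc m) k x y})
      (inj₂ (from (T-any-allFin (λ c′ → reach β (suc m) k x c′ ∧ cover β (suc m) c′ y))
        (c , from T-∧ (x≤c , from T-cover c⋖y))))

  reach-mono : ∀ {k j x y} → k ≤ j → T (reach β (suc m) k x y) → T (reach β (suc m) j x y)
  reach-mono {j = zero}  z≤n t = t
  reach-mono {k} {suc j} {x} {y} k≤1+j t with m≤n⇒m<n∨m≡n k≤1+j
  ... | inj₁ k<1+j = from (T-∨ {reach β (suc m) j x y}) (inj₁ (reach-mono (s≤s⁻¹ k<1+j) t))
  ... | inj₂ refl  = t

  ascent-reach : ∀ {x} k → Run true x k → T (reach β (suc m) k x (x ⊕ k))
  ascent-reach {x} zero    _ = from T-== (sym (⊕-identityʳ x))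
  ascent-reach {x} (suc k) r = reach-snoc {k} {x} {x ⊕ k} (ascent-reach k (Run-init r)) (up (sym (⊕-suc x k)) (Run-at r ≤-refl))

  descent-reach : ∀ {y} k → Run false y k → T (reach β (suc m) k (y ⊕ k) y)
  descent-reach {y} zero    _ = from T-== (⊕-identityʳ y)
  descent-reach {y} (suc k) (d ∷ r) =
    reach-snoc {k} {y ⊕ suc k} {y ⊕ 1}
      (subst (λ z → T (reach β (suc m) k z (y ⊕ 1))) (⊕-assoc y 1 k) (descent-reach k r)) (down refl d)

  module _ (mixed : ∀ b → ∃[ w ] dir w ≡ not b) where

    Run-bounded : ∀ {b x k} → Run b x k → k < suc m
    Run-bounded {b} {x} {k} r with k <? suc m | mixed b
    ... | yes k<n | _ = k<n
    ... | no  k≮n | w , dir-w≡¬b with ⊕-surjective x w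
    ... | i , i<n , refl = ⊥-elim (not-¬ (Run-at r (<-≤-trans i<n (≮⇒≥ k≮n))) dir-w≡¬b)

    Run-loop : ∀ {b x y k j} → Run b x k → Run b y j → y ≡ x ⊕ k → x ≡ y ⊕ j → y ≡ x
    Run-loop {x = x} {k = k} {j} r r′ refl x≡ = trans (cong (x ⊕_) k≡0) (⊕-identityʳ x)
      where
      k≡0 : k ≡ 0
      k≡0 = m+n≡0⇒m≡0 k (⊕-fixed x (k + j) (trans (sym (⊕-assoc x k j)) (sym x≡))
                                           (Run-bounded (Run-++ r r′)))

    ≼-antisym : ∀ {x y} → x ≼ y → y ≼ x → x ≡ y
    ≼-antisym {x} (ascent zero y≡ _) _ = trans (sym (⊕-identityʳ x)) (sym y≡)
    ≼-antisym {x} (descent zero x≡ _) _ = trans x≡ (⊕-identityʳ _)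
    ≼-antisym (ascent _ y≡ r) (ascent _ x≡ r′) = sym (Run-loop r r′ y≡ x≡)
    ≼-antisym (descent _ x≡ r) (descent _ y≡ r′) = Run-loop r r′ x≡ y≡
    ≼-antisym {x} (ascent (suc _) _ _) (descent zero y≡ _) = sym (trans y≡ (⊕-identityʳ x))
    ≼-antisym {y = y} (descent (suc _) _ _) (ascent zero x≡ _) = trans x≡ (⊕-identityʳ y)
    ≼-antisym (ascent (suc _) _ r) (descent (suc _) _ r′) = case trans (sym (Run-head r)) (Run-head r′) of λ ()
    ≼-antisym (descent (suc _) _ r) (ascent (suc _) _ r′) = case trans (sym (Run-head r′)) (Run-head r) of λ ()

    ≼⇒leq : ∀ {x y} → x ≼ y → T (leq β (suc m) x y)
    ≼⇒leq (ascent k refl r)  = reach-mono (<⇒≤ (Run-bounded r)) (ascent-reach k r)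
    ≼⇒leq (descent k refl r) = reach-mono (<⇒≤ (Run-bounded r)) (descent-reach k r)

    leq⇒≼ : ∀ {x y} → T (leq β (suc m) x y) → x ≼ y
    leq⇒≼ = ≼-reach (suc m) (≼-refl _)

    leq-isPartialOrder : IsPartialOrder _≡_ (λ x y → T (leq β (suc m) x y))
    leq-isPartialOrder = record
      { isPreorder = record
        { isEquivalence = isEquivalence
        ; reflexive     = λ { refl → ≼⇒leq (≼-refl _) }
        ; trans         = λ x≤y y≤z → ≼⇒leq (≼-reach (suc m) (leq⇒≼ x≤y) y≤z)
        }
      ; antisym = λ x≤y y≤x → ≼-antisym (leq⇒≼ x≤y) (leq⇒≼ y≤x)
      }

isMaximal : (β : List ℕ) (n : ℕ) → Subset n → Fin n → Bool
isMaximal β n I x = I x ∧ all (λ y → not (leq β n x y ∧ I y) ∨ (y == x)) (allFin n)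

maxCount-cong : ∀ β n {J J′ : Subset n} → J ≗ₛ J′ → maxCount β n J ≡ maxCount β n J′
maxCount-cong β n {J} {J′} J≗J′ = count-cong λ x → let e = isMaximal≡ x in mk⇔ (subst T e) (subst T (sym e))
  where
  isMaximal≡ : ∀ x → isMaximal β n J x ≡ isMaximal β n J′ x
  isMaximal≡ x = cong₂ _∧_ (J≗J′ x)
    (cong and (map-cong (λ y → cong (λ v → not (leq β n x y ∧ v) ∨ (y == x)) (J≗J′ y)) (allFin n)))

module Rowmotion (β : List ℕ) (n : ℕ) (isPartialOrder : IsPartialOrder _≡_ (λ x y → T (leq β n x y))) where

  infix 4 _⊑_

  _⊑_ : Fin n → Fin n → Set
  x ⊑ y = T (leq β n x y)

  open IsPartialOrder isPartialOrder using () renaming (refl to ⊑-refl; trans to ⊑-trans; antisym to ⊑-antisym)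

  MinimalOutside : Subset n → Fin n → Set
  MinimalOutside I x = ¬ T (I x) × (∀ y → y ⊑ x → ¬ T (I y) → y ≡ x)

  MaximalIn : Subset n → Fin n → Set
  MaximalIn I x = T (I x) × (∀ y → x ⊑ y → T (I y) → y ≡ x)

  T-minCompl : ∀ {I x} → T (minCompl β n I x) ⇔ MinimalOutside I x
  T-minCompl {I} {x} = mk⇔
    (λ t → let ∉I , below = to (T-∧ {not (I x)}) t in
      to T-not ∉I ,
      λ y y⊑x y∉I → to T-== (to (T-implies (leq β n y x) (not (I y)) (y == x))
                                  (to (T-all-allFin _) below y) y⊑x (from T-not y∉I)))
    (λ (∉I , minimal) → from (T-∧ {not (I x)})
      (from T-not ∉I ,
       from (T-all-allFin _) λ y → from (T-implies (leq β n y x) (not (I y)) (y == x))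
         λ y⊑x y∉I → from T-== (minimal y y⊑x (to T-not y∉I))))

  T-isMaximal : ∀ {I x} → T (isMaximal β n I x) ⇔ MaximalIn I x
  T-isMaximal {I} {x} = mk⇔
    (λ t → let ∈I , above = to (T-∧ {I x}) t in
      ∈I , λ y x⊑y y∈I → to T-== (to (T-implies (leq β n x y) (I y) (y == x)) (to (T-all-allFin _) above y) x⊑y y∈I))
    (λ (∈I , maximal) → from (T-∧ {I x})
      (∈I , from (T-all-allFin _) λ y → from (T-implies (leq β n x y) (I y) (y == x))
              λ x⊑y y∈I → from T-== (maximal y x⊑y y∈I)))

  T-ρ : ∀ {I x} → T (ρ β n I x) ⇔ (∃[ y ] MinimalOutside I y × x ⊑ y)
  T-ρ {I} {x} = mk⇔
    (λ t → let y , u = to (T-any-allFin _) t ; minimal , x⊑y = to (T-∧ {minCompl β n I y}) u in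
      y , to T-minCompl minimal , x⊑y)
    (λ (y , minimal , x⊑y) → from (T-any-allFin (λ z → minCompl β n I z ∧ leq β n x z))
      (y , from T-∧ (from T-minCompl minimal , x⊑y)))

  minimalOutside⇒ρ : ∀ {I x} → MinimalOutside I x → T (ρ β n I x)
  minimalOutside⇒ρ minimal = from T-ρ (_ , minimal , ⊑-refl)

  maximalIn-ρ : ∀ {I x} → MaximalIn (ρ β n I) x ⇔ MinimalOutside I x
  maximalIn-ρ {I} {x} = mk⇔
    (λ (x∈ρI , maximal) → let y , y-minimal , x⊑y = to T-ρ x∈ρI in
      subst (MinimalOutside I) (maximal y x⊑y (minimalOutside⇒ρ y-minimal)) y-minimal)
    (λ x-minimal@(x∉I , below) → minimalOutside⇒ρ x-minimal ,
      λ y x⊑y y∈ρI → let z , (_ , z-minimal) , y⊑z = to T-ρ y∈ρI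
                         x≡z = z-minimal x (⊑-trans x⊑y y⊑z) x∉I
                     in ⊑-antisym (subst (y ⊑_) (sym x≡z) y⊑z) x⊑y)

  module _ (I : Subset n) where

    outsideBelow : Fin n → ℕ
    outsideBelow y = count (λ w → leq β n w y ∧ not (I w))

    strictlyBelowOutside : Fin n → Fin n → Bool
    strictlyBelowOutside y w = leq β n w y ∧ not (I w) ∧ not (w == y)

    T-strictlyBelowOutside : ∀ {y w} → T (strictlyBelowOutside y w) ⇔ (w ⊑ y × ¬ T (I w) × w ≢ y)
    T-strictlyBelowOutside {y} {w} = mk⇔
      (λ t → let w⊑y , u = to (T-∧ {leq β n w y}) t ; w∉I , w≢y = to (T-∧ {not (I w)}) u in
        w⊑y , to T-not w∉I , to T-not w≢y ∘ from T-==)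
      (λ (w⊑y , w∉I , w≢y) → from (T-∧ {leq β n w y})
        (w⊑y , from (T-∧ {not (I w)}) (from T-not w∉I , from T-not (w≢y ∘ to T-==))))

    minimalOutside-below : ∀ y → ¬ T (I y) → ∃[ x ] MinimalOutside I x × x ⊑ y
    minimalOutside-below y = descend y (<-wellFounded (outsideBelow y))
      where
      descend : ∀ y → Acc _<_ (outsideBelow y) → ¬ T (I y) → ∃[ x ] MinimalOutside I x × x ⊑ y
      descend y (acc smaller) y∉I with T? (any (strictlyBelowOutside y) (allFin n))
      ... | no none = y , (y∉I , minimal) , ⊑-refl
        where
        minimal : ∀ w → w ⊑ y → ¬ T (I w) → w ≡ y
        minimal w w⊑y w∉I with w ≟ y
        ... | yes w≡y = w≡y
        ... | no  w≢y = ⊥-elim (none (from (T-any-allFin _) (w , from T-strictlyBelowOutside (w⊑y , w∉I , w≢y))))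
      ... | yes some with to (T-any-allFin _) some
      ... | w , t with to T-strictlyBelowOutside t
      ... | w⊑y , w∉I , w≢y =
        let x , x-minimal , x⊑w = descend w (smaller shrinks) w∉I in x , x-minimal , ⊑-trans x⊑w w⊑y
        where
        shrinks : outsideBelow w < outsideBelow y
        shrinks = count-< (λ v t → let v⊑w , v∉I = to T-∧ t in from T-∧ (⊑-trans v⊑w w⊑y , v∉I)) y
                          (from T-∧ (⊑-refl , from T-not y∉I))
                          (λ t → w≢y (⊑-antisym w⊑y (proj₁ (to T-∧ t))))

sum-applyUpTo-periodic : ∀ (g : ℕ → ℕ) k → g k ≡ g 0 → sum (applyUpTo (g ∘ suc) k) ≡ sum (applyUpTo g k)
sum-applyUpTo-periodic g k gk≡g0 = +-cancelˡ-≡ (g 0) _ _ (begin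
  sum (applyUpTo g (suc k))              ≡⟨ cong sum (applyUpTo-∷ʳ g k) ⟨
  sum (applyUpTo g k ∷ʳ g k)             ≡⟨ sum-++ (applyUpTo g k) [ g k ] ⟩
  sum (applyUpTo g k) + (g k + 0)        ≡⟨ cong (sum (applyUpTo g k) +_) (trans (+-identityʳ (g k)) gk≡g0) ⟩
  sum (applyUpTo g k) + g 0              ≡⟨ +-comm _ (g 0) ⟩
  g 0 + sum (applyUpTo g k)              ∎)
  where open ≡-Reasoning

sum-applyUpTo-complement : ∀ (f g : ℕ → ℕ) c k → (∀ i → f i + g i ≡ c) →
                           sum (applyUpTo f k) + sum (applyUpTo g k) ≡ c * k
sum-applyUpTo-complement f g c zero    _         = sym (*-zeroʳ c)
sum-applyUpTo-complement f g c (suc k) f+g≡c = begin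
  (f 0 + sum (applyUpTo (f ∘ suc) k)) + (g 0 + sum (applyUpTo (g ∘ suc) k))
    ≡⟨ +-interchange (f 0) _ (g 0) _ ⟩
  (f 0 + g 0) + (sum (applyUpTo (f ∘ suc) k) + sum (applyUpTo (g ∘ suc) k))
    ≡⟨ cong₂ _+_ (f+g≡c 0) (sum-applyUpTo-complement (f ∘ suc) (g ∘ suc) c k (f+g≡c ∘ suc)) ⟩
  c + c * k
    ≡⟨ *-suc c k ⟨
  c * suc k ∎
  where open ≡-Reasoning

module _ {β : List ℕ} {n : ℕ} where

  orbitSum-applyUpTo : ∀ (f : Subset n → ℕ) k I →
                       orbitSum β n f k I ≡ sum (applyUpTo (λ i → f (iter (ρ β n) i I)) k)
  orbitSum-applyUpTo f k I = cong sum (map-upTo (λ i → f (iter (ρ β n) i I)) k)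

  orbitSum-cong : ∀ {f g : Subset n → ℕ} → (∀ J → f J ≡ g J) → ∀ k I → orbitSum β n f k I ≡ orbitSum β n g k I
  orbitSum-cong f≡g k I = cong sum (map-cong (λ i → f≡g (iter (ρ β n) i I)) (upTo k))

  orbitSum-∘ρ : ∀ (f : Subset n → ℕ) k I → f (iter (ρ β n) k I) ≡ f I →
                orbitSum β n (f ∘ ρ β n) k I ≡ orbitSum β n f k I
  orbitSum-∘ρ f k I periodic = begin
    orbitSum β n (f ∘ ρ β n) k I                          ≡⟨ orbitSum-applyUpTo (f ∘ ρ β n) k I ⟩
    sum (applyUpTo (λ i → f (iter (ρ β n) (suc i) I)) k)   ≡⟨ sum-applyUpTo-periodic _ k periodic ⟩
    sum (applyUpTo (λ i → f (iter (ρ β n) i I)) k)         ≡⟨ orbitSum-applyUpTo f k I ⟨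
    orbitSum β n f k I                                    ∎
    where open ≡-Reasoning

  orbitSum-complement : ∀ (f g : Subset n → ℕ) c k I → (∀ J → f J + g J ≡ c) →
                        orbitSum β n f k I + orbitSum β n g k I ≡ c * k
  orbitSum-complement f g c k I f+g≡c =
    trans (cong₂ _+_ (orbitSum-applyUpTo f k I) (orbitSum-applyUpTo g k I))
          (sum-applyUpTo-complement _ _ c k (λ i → f+g≡c (iter (ρ β n) i I)))

upAux-< : ∀ p a as {j} → j < a → upAux p (a ∷ as) j ≡ p
upAux-< p a as {j} j<a with j <ᵇ a | <⇒<ᵇ j<a
... | true | _ = refl

upAux-+ : ∀ p a as j → upAux p (a ∷ as) (a + j) ≡ upAux (not p) as j
upAux-+ p a as j with (a + j) <ᵇ a | <ᵇ⇒< (a + j) a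
... | true  | a+j<a = ⊥-elim (m+n≮m a j (a+j<a tt))
... | false | _     = cong (upAux (not p) as) (m+n∸m≡n a j)

upAux-not : ∀ p xs j → upAux (not p) xs j ≡ not (upAux p xs j)
upAux-not p []       j = refl
upAux-not p (x ∷ xs) j with j <ᵇ x
... | true  = refl
... | false = upAux-not (not p) xs (j ∸ x)

upAux-++ˡ : ∀ p xs ys {j} → j < sum xs → upAux p (xs ++ ys) j ≡ upAux p xs j
upAux-++ˡ p (x ∷ xs) ys {j} j<Σ with j <ᵇ x in j<ᵇx
... | true  = refl
... | false = upAux-++ˡ (not p) xs ys
                (subst (j ∸ x <_) (m+n∸m≡n x (sum xs))
                       (∸-monoˡ-< {n = x} j<Σ (≮⇒≥ (λ j<x → subst T j<ᵇx (<⇒<ᵇ j<x)))))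

upAux-++ʳ : ∀ p xs ys j → upAux p (xs ++ ys) (sum xs + j) ≡ iter not (length xs) (upAux p ys j)
upAux-++ʳ p []       ys j = refl
upAux-++ʳ p (x ∷ xs) ys j = begin
  upAux p (x ∷ xs ++ ys) (x + sum xs + j)       ≡⟨ cong (upAux p (x ∷ xs ++ ys)) (+-assoc x (sum xs) j) ⟩
  upAux p (x ∷ xs ++ ys) (x + (sum xs + j))     ≡⟨ upAux-+ p x (xs ++ ys) (sum xs + j) ⟩
  upAux (not p) (xs ++ ys) (sum xs + j)         ≡⟨ upAux-not p (xs ++ ys) (sum xs + j) ⟩
  not (upAux p (xs ++ ys) (sum xs + j))         ≡⟨ cong not (upAux-++ʳ p xs ys j) ⟩
  not (iter not (length xs) (upAux p ys j))     ∎
  where open ≡-Reasoning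

iter-not-+-self : ∀ k b → iter not (k + k) b ≡ b
iter-not-+-self zero    b = refl
iter-not-+-self (suc k) b = begin
  not (iter not (k + suc k) b)       ≡⟨ cong (λ i → not (iter not i b)) (+-suc k k) ⟩
  not (not (iter not (k + k) b))     ≡⟨ not-involutive _ ⟩
  iter not (k + k) b                 ≡⟨ iter-not-+-self k b ⟩
  b                                  ∎
  where open ≡-Reasoning

mixed-directions : ∀ a′ b′ bs b →
  ∃[ w ] upStep (suc a′ ∷ suc b′ ∷ bs) (toℕ {suc (a′ + sum (suc b′ ∷ bs))} w) ≡ not b
mixed-directions a′ b′ bs true = fromℕ< a<n , (begin
  upStep α (toℕ (fromℕ< {n = n} a<n))  ≡⟨ cong (upStep α) (trans (toℕ-fromℕ< a<n) (sym (+-identityʳ (suc a′)))) ⟩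
  upStep α (suc a′ + 0)          ≡⟨ upAux-+ true (suc a′) (suc b′ ∷ bs) 0 ⟩
  upAux false (suc b′ ∷ bs) 0    ≡⟨ upAux-< false (suc b′) bs z<s ⟩
  false                          ∎)
  where
  open ≡-Reasoning
  α = suc a′ ∷ suc b′ ∷ bs
  n = suc (a′ + sum (suc b′ ∷ bs))
  a<n : suc a′ < n
  a<n = s≤s (m<m+n a′ z<s)
mixed-directions a′ b′ bs false = fzero {n = a′ + sum (suc b′ ∷ bs)} , upAux-< true (suc a′) (suc b′ ∷ bs) z<s

module Composition (a : ℕ) (as : List ℕ) (m s : ℕ) (a+Σas≡n : a + sum as ≡ suc m)
                   (even : length (a ∷ as) ≡ 2 * s)
                   (mixed : ∀ b → ∃[ w ] upStep (a ∷ as) (toℕ {suc m} w) ≡ not b) where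

  open Shift m

  α : List ℕ
  α = a ∷ as

  n : ℕ
  n = suc m

  -- ψ x is the element of F̄(α) lying over x ∈ F̄(sh α), so that κ α n J x = not (J (ψ x)).
  ψ ψ⁻¹ : Fin n → Fin n
  ψ x = x ⊕ a
  ψ⁻¹ x = x ⊕ sum as

  ψ-ψ⁻¹ : ∀ x → ψ (ψ⁻¹ x) ≡ x
  ψ-ψ⁻¹ = ⊕-inverse (trans (+-comm (sum as) a) a+Σas≡n)

  ψ⁻¹-ψ : ∀ x → ψ⁻¹ (ψ x) ≡ x
  ψ⁻¹-ψ = ⊕-inverse a+Σas≡n

  ψ-injective : ∀ {x y} → ψ x ≡ ψ y → x ≡ y
  ψ-injective = ⊕-cancelʳ (sum as) a+Σas≡n

  ∀-ψ : {P : Fin n → Set} → (∀ y → P (ψ y)) → ∀ y → P y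
  ∀-ψ {P} f y = subst P (ψ-ψ⁻¹ y) (f (ψ⁻¹ y))

  iter-not-length-as : iter not (length as) true ≡ false
  iter-not-length-as = not-injective (begin
    iter not (suc (length as)) true  ≡⟨ cong (λ k → iter not k true) (trans even (cong (s +_) (+-identityʳ s))) ⟩
    iter not (s + s) true            ≡⟨ iter-not-+-self s true ⟩
    true                             ∎)
    where open ≡-Reasoning

  dir-sh-< : ∀ x → toℕ x < sum as → upStep (sh α) (toℕ x) ≡ not (upStep α (toℕ (ψ x)))
  dir-sh-< x x<Σ = begin
    upAux true (as ++ [ a ]) (toℕ x)    ≡⟨ upAux-++ˡ true as [ a ] x<Σ ⟩
    upAux true as (toℕ x)               ≡⟨ not-involutive _ ⟨
    not (not (upAux true as (toℕ x)))   ≡⟨ cong not (upAux-not true as (toℕ x)) ⟨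
    not (upAux false as (toℕ x))        ≡⟨ cong not (upAux-+ true a as (toℕ x)) ⟨
    not (upStep α (a + toℕ x))          ≡⟨ cong (not ∘ upStep α) toℕ-ψx ⟨
    not (upStep α (toℕ (ψ x)))          ∎
    where
    open ≡-Reasoning
    toℕ-ψx : toℕ (ψ x) ≡ a + toℕ x
    toℕ-ψx = trans (toℕ-⊕-< x a (subst (toℕ x + a <_) (trans (+-comm (sum as) a) a+Σas≡n) (+-monoˡ-< a x<Σ)))
                   (+-comm (toℕ x) a)

  dir-sh-≥ : ∀ x d → toℕ x ≡ sum as + d → upStep (sh α) (toℕ x) ≡ not (upStep α (toℕ (ψ x)))
  dir-sh-≥ x d x≡Σas+d = begin
    upAux true (as ++ [ a ]) (toℕ x)          ≡⟨ cong (upAux true (as ++ [ a ])) x≡Σas+d ⟩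
    upAux true (as ++ [ a ]) (sum as + d)     ≡⟨ upAux-++ʳ true as [ a ] d ⟩
    iter not (length as) (upAux true [ a ] d) ≡⟨ cong (iter not (length as)) (upAux-< true a [] d<a) ⟩
    iter not (length as) true                 ≡⟨ iter-not-length-as ⟩
    false                                     ≡⟨ cong not (upAux-< true a as d<a) ⟨
    not (upStep α d)                          ≡⟨ cong (not ∘ upStep α) toℕ-ψx ⟨
    not (upStep α (toℕ (ψ x)))                ∎
    where
    open ≡-Reasoning
    d<a : d < a
    d<a = +-cancelˡ-< (sum as) d a (subst₂ _<_ x≡Σas+d (trans (sym a+Σas≡n) (+-comm a (sum as))) (toℕ<n x))
    toℕ-ψx : toℕ (ψ x) ≡ d
    toℕ-ψx = begin
      toℕ (x ⊕ a)           ≡⟨ toℕ-⊕ x a ⟩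
      (toℕ x + a) % n       ≡⟨ cong (λ v → (v + a) % n) x≡Σas+d ⟩
      (sum as + d + a) % n  ≡⟨ cong (_% n) (trans (+-comm (sum as + d) a)
                                  (trans (sym (+-assoc a (sum as) d)) (cong (_+ d) a+Σas≡n))) ⟩
      (n + d) % n           ≡⟨ cong (_% n) (+-comm n d) ⟩
      (d + n) % n           ≡⟨ [m+n]%n≡m%n d n ⟩
      d % n                 ≡⟨ m<n⇒m%n≡m (<-≤-trans d<a (subst (a ≤_) a+Σas≡n (m≤m+n a (sum as)))) ⟩
      d                     ∎

  dir-sh : ∀ x → upStep (sh α) (toℕ x) ≡ not (upStep α (toℕ (ψ x)))
  dir-sh x with toℕ x <? sum as
  ... | yes x<Σ = dir-sh-< x x<Σ
  ... | no  x≮Σ = dir-sh-≥ x (toℕ x ∸ sum as) (sym (m+[n∸m]≡n (≮⇒≥ x≮Σ)))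

  module F  = CircularFence α m
  module F′ = CircularFence (sh α) m
  open F using ([]; _∷_)

  mixed′ : ∀ b → ∃[ w ] F′.dir w ≡ not b
  mixed′ b = let w , w≡ = mixed (not b) in
    ψ⁻¹ w , trans (dir-sh (ψ⁻¹ w)) (trans (cong (not ∘ F.dir) (ψ-ψ⁻¹ w)) (trans (cong not w≡) (not-involutive (not b))))

  Run-dual : ∀ {b x k} → F′.Run b x k → F.Run (not b) (ψ x) k
  Run-dual F′.[]               = []
  Run-dual {b} {x} (d F′.∷ r) =
    trans (sym (not-involutive _)) (cong not (trans (sym (dir-sh x)) d)) ∷
    subst (λ z → F.Run (not b) z _) (⊕-comm x 1 a) (Run-dual r)

  Run-dual⁻¹ : ∀ b {x k} → F.Run (not b) (ψ x) k → F′.Run b x k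
  Run-dual⁻¹ b     []      = F′.[]
  Run-dual⁻¹ b {x} (d ∷ r) =
    trans (dir-sh x) (trans (cong not d) (not-involutive b)) F′.∷
    Run-dual⁻¹ b (subst (λ z → F.Run (not b) z _) (sym (⊕-comm x 1 a)) r)

  ≼-dual : ∀ {x y} → x F′.≼ y ⇔ ψ y F.≼ ψ x
  ≼-dual {x} {y} = mk⇔
    (λ { (F′.ascent  k y≡ r) → F.descent k (trans (cong ψ y≡) (⊕-comm x k a)) (Run-dual r)
       ; (F′.descent k x≡ r) → F.ascent  k (trans (cong ψ x≡) (⊕-comm y k a)) (Run-dual r) })
    (λ { (F.ascent  k x≡ r) → F′.descent k (ψ-injective (trans x≡ (sym (⊕-comm y k a)))) (Run-dual⁻¹ false r)
       ; (F.descent k y≡ r) → F′.ascent  k (ψ-injective (trans y≡ (sym (⊕-comm x k a)))) (Run-dual⁻¹ true r) })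

  module R  = Rowmotion α n (F.leq-isPartialOrder mixed)
  module R′ = Rowmotion (sh α) n (F′.leq-isPartialOrder mixed′)

  leq-dual : ∀ {x y} → x R′.⊑ y ⇔ ψ y R.⊑ ψ x
  leq-dual = mk⇔ (F.≼⇒leq mixed ∘ to ≼-dual ∘ F′.leq⇒≼ mixed′)
                 (F′.≼⇒leq mixed′ ∘ from ≼-dual ∘ F.leq⇒≼ mixed)

  minimalOutside-κ : ∀ {J x} → R′.MinimalOutside (κ α n J) x ⇔ R.MaximalIn J (ψ x)
  minimalOutside-κ = mk⇔
    (λ (x∉κJ , minimal) → to ¬T-not x∉κJ ,
      ∀-ψ λ y ψx⊑ψy ψy∈J → cong ψ (minimal y (from leq-dual ψx⊑ψy) (from ¬T-not ψy∈J)))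
    (λ (ψx∈J , maximal) → from ¬T-not ψx∈J ,
      λ y y⊑x y∉κJ → ψ-injective (maximal (ψ y) (to leq-dual y⊑x) (to ¬T-not y∉κJ)))

  maximalIn-κ : ∀ {J x} → R′.MaximalIn (κ α n J) x ⇔ R.MinimalOutside J (ψ x)
  maximalIn-κ = mk⇔
    (λ (x∈κJ , maximal) → to T-not x∈κJ ,
      ∀-ψ λ y ψy⊑ψx ψy∉J → cong ψ (maximal y (from leq-dual ψy⊑ψx) (from T-not ψy∉J)))
    (λ (ψx∉J , minimal) → from T-not ψx∉J ,
      λ y x⊑y y∈κJ → ψ-injective (minimal (ψ y) (to leq-dual x⊑y) (to T-not y∈κJ)))

  ρ-κ-ρ : ∀ I → IsLowerIdeal α n I → ρ (sh α) n (κ α n (ρ α n I)) ≗ₛ κ α n I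
  ρ-κ-ρ I lower x = ⇔⇒≡ (mk⇔ ⇒ ⇐)
    where
    ⇒ : T (ρ (sh α) n (κ α n (ρ α n I)) x) → T (κ α n I x)
    ⇒ t = let y , y-minimal , x⊑y = to R′.T-ρ t
              ψy∉I , _ = to (R.maximalIn-ρ {I}) (to (minimalOutside-κ {ρ α n I}) y-minimal)
          in from T-not (ψy∉I ∘ lower (ψ y) (ψ x) (to leq-dual x⊑y))
    ⇐ : T (κ α n I x) → T (ρ (sh α) n (κ α n (ρ α n I)) x)
    ⇐ t = let y , y-minimal , y⊑ψx = R.minimalOutside-below I (ψ x) (to T-not t)
              ψy′-minimal , ψy′⊑ψx = subst (λ z → R.MinimalOutside I z × z R.⊑ ψ x) (sym (ψ-ψ⁻¹ y))
                                           (y-minimal , y⊑ψx)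
          in from R′.T-ρ (ψ⁻¹ y , from (minimalOutside-κ {ρ α n I}) (from (R.maximalIn-ρ {I}) ψy′-minimal) ,
                          from leq-dual ψy′⊑ψx)

  maxCount-κ : ∀ J → maxCount (sh α) n (κ α n J) ≡ maxCount α n (ρ α n J)
  maxCount-κ J = begin
    count (isMaximal (sh α) n (κ α n J))  ≡⟨ count-cong maximal-κ ⟩
    count (minCompl α n J ∘ ψ)            ≡⟨ count-∘-bijection ψ ψ⁻¹ ψ-ψ⁻¹ ψ⁻¹-ψ (minCompl α n J) ⟩
    count (minCompl α n J)                ≡⟨ count-cong minCompl-maximal-ρ ⟩
    count (isMaximal α n (ρ α n J))       ∎
    where
    open ≡-Reasoning
    maximal-κ : ∀ x → T (isMaximal (sh α) n (κ α n J) x) ⇔ T (minCompl α n J (ψ x))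
    maximal-κ x = ⇔.trans R′.T-isMaximal (⇔.trans (maximalIn-κ {J} {x}) (⇔.sym (R.T-minCompl {J} {ψ x})))
    minCompl-maximal-ρ : ∀ x → T (minCompl α n J x) ⇔ T (isMaximal α n (ρ α n J) x)
    minCompl-maximal-ρ x = ⇔.trans R.T-minCompl (⇔.trans (⇔.sym (R.maximalIn-ρ {J} {x})) (⇔.sym R.T-isMaximal))

  size-κ : ∀ J → size J + size (κ α n J) ≡ n
  size-κ J = trans (cong (size J +_) (count-∘-bijection ψ ψ⁻¹ ψ-ψ⁻¹ ψ⁻¹-ψ (not ∘ J))) (count-complement J)

lemma8p4 : (n s : ℕ) (α : List ℕ) → 1 ≤ s → length α ≡ 2 * s → All (1 ≤_) α → sum α ≡ n →
    ((I : Subset n) → IsLowerIdeal α n I →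
      ρ (sh α) n (κ α n (ρ α n I)) ≗ₛ κ α n I)
    × ((I : Subset n) → IsLowerIdeal α n I → (k : ℕ) → 1 ≤ k →
        iter (ρ α n) k I ≗ₛ I →
        ((j : ℕ) → 1 ≤ j → j < k → ¬ (iter (ρ α n) j I ≗ₛ I)) →
        (orbitSum α n (maxCount α n) k I ≡ orbitSum α n (λ J → maxCount (sh α) n (κ α n J)) k I)
        × (orbitSum α n size k I + orbitSum α n (λ J → size (κ α n J)) k I ≡ n * k))
lemma8p4 _ (suc _)       []        _ () _ _
lemma8p4 _ (suc zero)    (_ ∷ [])  _ () _ _
lemma8p4 _ (suc (suc _)) (_ ∷ [])  _ () _ _
lemma8p4 _ s (suc a′ ∷ suc b′ ∷ bs) _ even (s≤s z≤n ∷ s≤s z≤n ∷ _) refl =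
  ρ-κ-ρ ,
  λ I _ k _ periodic _ →
    (begin
      orbitSum α n (maxCount α n) k I             ≡⟨ orbitSum-∘ρ (maxCount α n) k I (maxCount-cong α n periodic) ⟨
      orbitSum α n (maxCount α n ∘ ρ α n) k I     ≡⟨ orbitSum-cong (sym ∘ maxCount-κ) k I ⟩
      orbitSum α n (maxCount (sh α) n ∘ κ α n) k I ∎) ,
    orbitSum-complement size (size ∘ κ α n) n k I size-κ
  where
  open Composition (suc a′) (suc b′ ∷ bs) (a′ + sum (suc b′ ∷ bs)) s refl even (mixed-directions a′ b′ bs)
  open ≡-Reasoning
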